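{- Let $I=(G,L)$ be an instance of the Stable Matching Problem, let $k$ be the minimum number of swaps that leads from $I$ to an instance (on the same graph $G$) having a perfect stable matching, and let $n_u$ be the number of vertices unmatched in any stable matching of $I$. Then $n_u\le 2k$.
   Context: An instance of the Stable Matching Problem is a bipartite graph $G=(A,B;E)$ together with a set $L$ of preference lists: for each vertex $v$, a strict ordering $\ell(v)$ of all neighbours of $v$ ($v$ prefers earlier elements). For a matching $M$, an edge $ab\in E\setminus M$ is blocking if ($a$ is unmatched in $M$ or $a$ prefers $b$ to its partner in $M$) and ($b$ is unmatched in $M$ or $b$ prefers $a$ to its partner in $M$). $M$ is stable if it has no blocking edge; a matching is perfect if it covers all vertices. A swap exchanges two consecutive elements of one preference list. (By the Rural Hospitals Theorem the set of unmatched vertices is the same in every stable matching, so $n_u$ is well defined.) -}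

module Defs where

open import Data.Nat using (ℕ; zero; suc)
open import Data.Fin using (Fin)
open import Data.Maybe using (Maybe; just; nothing; is-nothing)
open import Data.List using (List; []; _∷_; _++_; length; filter; allFin)
open import Data.List.Membership.Propositional using (_∈_)
open import Data.List.Relation.Unary.Unique.Propositional using (Unique)
open import Data.Product using (Σ; ∃; ∃-syntax; _×_; _,_)
open import Data.Sum using (_⊎_)
open import Data.Bool using (T)
open import Relation.Nullary using (¬_)
open import Relation.Unary using (Pred)
open import Relation.Binary.PropositionalEquality using (_≡_; _≢_)
open import Function.Bundles using (_⇔_)
open import Level using (0ℓ)

Graph : ℕ → ℕ → Set₁
Graph na nb = Fin na → Fin nb → Set

record Prefs (na nb : ℕ) : Set where
  constructor prefs
  field
    prefA : Fin na → List (Fin nb)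
    prefB : Fin nb → List (Fin na)
open Prefs public

ValidPrefs : ∀ {na nb} → Graph na nb → Prefs na nb → Set
ValidPrefs {na} {nb} E L =
  (∀ (a : Fin na) → Unique (prefA L a) × (∀ (b : Fin nb) → (b ∈ prefA L a) ⇔ E a b)) ×
  (∀ (b : Fin nb) → Unique (prefB L b) × (∀ (a : Fin na) → (a ∈ prefB L b) ⇔ E a b))

-- x occurs strictly before y in the list (the vertex prefers x to y).
data Before {X : Set} (x y : X) : List X → Set where
  here  : ∀ {l} → y ∈ l → Before x y (x ∷ l)
  there : ∀ {z l} → Before x y l → Before x y (z ∷ l)

record Matching {na nb : ℕ} (E : Graph na nb) : Set where
  constructor matching
  field
    mA : Fin na → Maybe (Fin nb)
    mB : Fin nb → Maybe (Fin na)
    consistent : ∀ a b → (mA a ≡ just b) ⇔ (mB b ≡ just a)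
    inE : ∀ a b → mA a ≡ just b → E a b
open Matching public

WouldPrefer : ∀ {X : Set} → List X → Maybe X → X → Set
WouldPrefer l p w = (p ≡ nothing) ⊎ (∃[ w' ] (p ≡ just w' × Before w w' l))

Blocking : ∀ {na nb} {E : Graph na nb} → Prefs na nb → Matching E → Fin na → Fin nb → Set
Blocking {E = E} L M a b =
  E a b × mA M a ≢ just b ×
  WouldPrefer (prefA L a) (mA M a) b × WouldPrefer (prefB L b) (mB M b) a

Stable : ∀ {na nb} {E : Graph na nb} → Prefs na nb → Matching E → Set
Stable L M = ∀ a b → ¬ Blocking L M a b

Perfect : ∀ {na nb} {E : Graph na nb} → Matching E → Set
Perfect M = (∀ a → mA M a ≢ nothing) × (∀ b → mB M b ≢ nothing)

unmatched : ∀ {na nb} {E : Graph na nb} → Matching E → ℕ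
unmatched {na} {nb} M =
  length (filter (λ a → Data.Bool._≟_ (is-nothing (mA M a)) Data.Bool.true) (allFin na))
  Data.Nat.+
  length (filter (λ b → Data.Bool._≟_ (is-nothing (mB M b)) Data.Bool.true) (allFin nb))
  where import Data.Bool
        import Data.Nat

data SwapList {X : Set} : List X → List X → Set where
  swapAt : ∀ xs x y ys → SwapList (xs ++ x ∷ y ∷ ys) (xs ++ y ∷ x ∷ ys)

data SwapStep {na nb : ℕ} : Prefs na nb → Prefs na nb → Set where
  swapA : ∀ {L L'} (a : Fin na) →
          SwapList (prefA L a) (prefA L' a) →
          (∀ a' → a' ≢ a → prefA L' a' ≡ prefA L a') →
          (∀ b → prefB L' b ≡ prefB L b) → SwapStep L L'
  swapB : ∀ {L L'} (b : Fin nb) →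
          SwapList (prefB L b) (prefB L' b) →
          (∀ b' → b' ≢ b → prefB L' b' ≡ prefB L b') →
          (∀ a → prefA L' a ≡ prefA L a) → SwapStep L L'

data Swaps {na nb : ℕ} : ℕ → Prefs na nb → Prefs na nb → Set where
  done : ∀ {L} → Swaps zero L L
  step : ∀ {k L L' L''} → SwapStep L L' → Swaps k L' L'' → Swaps (suc k) L L''

HasPerfectStable : ∀ {na nb} → Graph na nb → Prefs na nb → Set
HasPerfectStable E L = Σ (Matching E) (λ M → Stable L M × Perfect M)

-- Fix a perfect matching M' stable for L'. Call a vertex L-biased if, under L, it strictly
-- prefers its M-partner to its M'-partner. Stability of M under L: every edge a M'(a) outside
-- M has an L-biased endpoint; charging a ∈ A to a and M'(a), the vertices of A unmatched or
-- repartnered by M number at most the L-biased vertices. Stability of M' under L': no edge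
-- a M(a) has both endpoints L'-biased, so the L'-biased vertices number at most the
-- repartnered (matched) vertices of A. Hence the unmatched vertices of A are at most the
-- vertices whose bias differs between L and L'; a swap alters one list, so there are at
-- most k of them. The side B is the same statement for the transposed instance.
module Submission where

open import Defs
open import Data.Bool using (Bool; true; false; not; _xor_; if_then_else_)
import Data.Bool as Bool
open import Data.Bool.Properties using (xor-same)
open import Data.Empty using (⊥-elim)
open import Data.Fin using (Fin; zero; suc; _≟_; punchIn)
open import Data.Fin.Properties using (punchInᵢ≢i)
open import Data.List using (List; []; _∷_; length; filter; tabulate)
open import Data.List.Membership.Propositional using (_∈_)
import Data.List.Membership.DecPropositional as DecMembership
import Data.List.Relation.Unary.Any as Any
open import Data.Maybe using (Maybe; just; nothing; maybe; is-nothing)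
import Data.Maybe.Properties as Maybe
open import Data.Nat using (ℕ; zero; suc; _+_; _*_; _≤_; z≤n; s≤s)
open import Data.Nat.Properties
  using (≤-refl; ≤-reflexive; ≤-trans; +-comm; +-assoc; +-identityʳ; +-mono-≤; +-monoʳ-≤; +-cancelʳ-≤;
         module ≤-Reasoning; +-0-commutativeMonoid; +-commutativeSemigroup)
open import Data.Product using (_×_; _,_; proj₁; proj₂; uncurry)
open import Data.Sum as Sum using (_⊎_; inj₁; inj₂)
open import Data.Vec.Functional using (Vector)
open import Function using (_∘_; id; const; flip)
open import Function.Bundles using (Equivalence; mk⇔)
open import Relation.Binary.Definitions using (DecidableEquality)
open import Relation.Binary.PropositionalEquality
open import Relation.Nullary using (¬_; Dec; yes; no; does; ¬?)
open import Relation.Nullary.Decidable using (map′; _×-dec_; _⊎-dec_; dec-true; dec-false; does-⇔)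

open import Algebra.Properties.CommutativeMonoid.Sum +-0-commutativeMonoid
  using (sum; sum-syntax; sum-cong-≗; sum-remove; sum-replicate-zero; ∑-distrib-+; ∑-comm)
open import Algebra.Properties.CommutativeSemigroup +-commutativeSemigroup using (interchange)

𝟙 : Bool → ℕ
𝟙 b = if b then 1 else 0

𝟙-≤-1 : ∀ x → 𝟙 x ≤ 1
𝟙-≤-1 true  = s≤s z≤n
𝟙-≤-1 false = z≤n

𝟙-xor-≡ : ∀ {x y} → x ≡ y → 𝟙 (x xor y) ≡ 0
𝟙-xor-≡ {x} refl = cong 𝟙 (xor-same x)

𝟙-does-⊎ : ∀ {P Q : Set} (P? : Dec P) (Q? : Dec Q) → P ⊎ Q → 1 ≤ 𝟙 (does P?) + 𝟙 (does Q?)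
𝟙-does-⊎ (yes _)  _        _   = s≤s z≤n
𝟙-does-⊎ (no _)   (yes _)  _   = s≤s z≤n
𝟙-does-⊎ (no ¬p)  (no ¬q)  p⊎q = ⊥-elim (Sum.[ ¬p , ¬q ] p⊎q)

𝟙-does-¬× : ∀ {P Q : Set} (P? : Dec P) (Q? : Dec Q) → ¬ (P × Q) → 𝟙 (does P?) + 𝟙 (does Q?) ≤ 1
𝟙-does-¬× (yes p) (yes q) ¬p×q = ⊥-elim (¬p×q (p , q))
𝟙-does-¬× (yes _) (no _)  _    = ≤-refl
𝟙-does-¬× (no _)  _       _    = 𝟙-≤-1 _

∑-mono-≤ : ∀ {n} {f g : Vector ℕ n} → (∀ i → f i ≤ g i) → sum f ≤ sum g
∑-mono-≤ {zero}  f≤g = z≤n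
∑-mono-≤ {suc n} f≤g = +-mono-≤ (f≤g zero) (∑-mono-≤ (f≤g ∘ suc))

∑-zero : ∀ n {f : Vector ℕ n} → (∀ i → f i ≡ 0) → sum f ≡ 0
∑-zero n f≡0 = trans (sum-cong-≗ f≡0) (sum-replicate-zero n)

∑-concentrated : ∀ {n} (f : Vector ℕ n) i → (∀ j → j ≢ i → f j ≡ 0) → sum f ≡ f i
∑-concentrated {suc n} f i f≡0 = begin
  sum f                       ≡⟨ sum-remove f ⟩
  f i + sum (f ∘ punchIn i)   ≡⟨ cong (f i +_) (∑-zero n (λ j → f≡0 (punchIn i j) (punchInᵢ≢i i j))) ⟩
  f i + 0                     ≡⟨ +-identityʳ (f i) ⟩
  f i                         ∎
  where open ≡-Reasoning

length-filter-tabulate : ∀ {A : Set} {n} (f : A → Bool) (g : Fin n → A) →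
  length (filter (λ x → f x Bool.≟ true) (tabulate g)) ≡ ∑[ i < n ] 𝟙 (f (g i))
length-filter-tabulate {n = zero}  f g = refl
length-filter-tabulate {n = suc n} f g with f (g zero)
... | true  = cong suc (length-filter-tabulate f (g ∘ suc))
... | false = length-filter-tabulate f (g ∘ suc)

weight : ∀ {n} → Vector Bool n → ℕ
weight {n} u = ∑[ i < n ] 𝟙 (u i)

hamming : ∀ {n} → Vector Bool n → Vector Bool n → ℕ
hamming {n} u v = ∑[ i < n ] 𝟙 (u i xor v i)

weight-≤-weight+hamming : ∀ {n} (u v : Vector Bool n) → weight u ≤ weight v + hamming u v
weight-≤-weight+hamming {n} u v = begin
  weight u                                    ≤⟨ ∑-mono-≤ (λ i → 𝟙-≤-xor (u i) (v i)) ⟩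
  ∑[ i < n ] (𝟙 (v i) + 𝟙 (u i xor v i))      ≡⟨ ∑-distrib-+ (𝟙 ∘ v) _ ⟩
  weight v + hamming u v                      ∎
  where
  open ≤-Reasoning
  𝟙-≤-xor : ∀ x y → 𝟙 x ≤ 𝟙 y + 𝟙 (x xor y)
  𝟙-≤-xor true  true  = s≤s z≤n
  𝟙-≤-xor true  false = s≤s z≤n
  𝟙-≤-xor false _     = z≤n

hamming-triangle : ∀ {n} (u v w : Vector Bool n) → hamming u w ≤ hamming u v + hamming v w
hamming-triangle {n} u v w = begin
  hamming u w                                           ≤⟨ ∑-mono-≤ (λ i → 𝟙-xor-triangle (u i) (v i) (w i)) ⟩
  ∑[ i < n ] (𝟙 (u i xor v i) + 𝟙 (v i xor w i))        ≡⟨ ∑-distrib-+ (λ i → 𝟙 (u i xor v i)) (λ i → 𝟙 (v i xor w i)) ⟩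
  hamming u v + hamming v w                             ∎
  where
  open ≤-Reasoning
  𝟙-xor-triangle : ∀ x y z → 𝟙 (x xor z) ≤ 𝟙 (x xor y) + 𝟙 (y xor z)
  𝟙-xor-triangle true  true  _     = ≤-refl
  𝟙-xor-triangle false false _     = ≤-refl
  𝟙-xor-triangle true  false true  = z≤n
  𝟙-xor-triangle true  false false = s≤s z≤n
  𝟙-xor-triangle false true  true  = s≤s z≤n
  𝟙-xor-triangle false true  false = z≤n

hamming-≗ : ∀ {n} {u v : Vector Bool n} → (∀ i → u i ≡ v i) → hamming u v ≡ 0
hamming-≗ {n} u≗v = ∑-zero n (𝟙-xor-≡ ∘ u≗v)

hamming-refl : ∀ {n} (u : Vector Bool n) → hamming u u ≡ 0
hamming-refl u = hamming-≗ {u = u} (λ _ → refl)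

hamming-≤-1 : ∀ {n} {u v : Vector Bool n} i → (∀ j → j ≢ i → u j ≡ v j) → hamming u v ≤ 1
hamming-≤-1 {u = u} {v} i agree = begin
  hamming u v         ≡⟨ ∑-concentrated _ i (λ j j≢i → 𝟙-xor-≡ (agree j j≢i)) ⟩
  𝟙 (u i xor v i)     ≤⟨ 𝟙-≤-1 (u i xor v i) ⟩
  1                   ∎
  where open ≤-Reasoning

module LocalStatistic {na nb : ℕ}
  (β : Fin na → List (Fin nb) → Bool) (γ : Fin nb → List (Fin na) → Bool) where

  bitsA : Prefs na nb → Vector Bool na
  bitsA L a = β a (prefA L a)

  bitsB : Prefs na nb → Vector Bool nb
  bitsB L b = γ b (prefB L b)

  changes : Prefs na nb → Prefs na nb → ℕ
  changes L L' = hamming (bitsA L) (bitsA L') + hamming (bitsB L) (bitsB L')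

  count : Prefs na nb → ℕ
  count L = weight (bitsA L) + weight (bitsB L)

  count-≤-count+changes : ∀ L L' → count L ≤ count L' + changes L L'
  count-≤-count+changes L L' = begin
    count L
      ≤⟨ +-mono-≤ (weight-≤-weight+hamming (bitsA L) (bitsA L')) (weight-≤-weight+hamming (bitsB L) (bitsB L')) ⟩
    (weight (bitsA L') + hamming (bitsA L) (bitsA L')) + (weight (bitsB L') + hamming (bitsB L) (bitsB L'))
      ≡⟨ interchange (weight (bitsA L')) _ (weight (bitsB L')) _ ⟩
    count L' + changes L L' ∎
    where open ≤-Reasoning

  changes-refl : ∀ L → changes L L ≡ 0
  changes-refl L = cong₂ _+_ (hamming-refl (bitsA L)) (hamming-refl (bitsB L))

  changes-triangle : ∀ L₁ L₂ L₃ → changes L₁ L₃ ≤ changes L₁ L₂ + changes L₂ L₃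
  changes-triangle L₁ L₂ L₃ = begin
    changes L₁ L₃
      ≤⟨ +-mono-≤ (hamming-triangle (bitsA L₁) (bitsA L₂) (bitsA L₃))
                  (hamming-triangle (bitsB L₁) (bitsB L₂) (bitsB L₃)) ⟩
    (hamming (bitsA L₁) (bitsA L₂) + hamming (bitsA L₂) (bitsA L₃)) +
    (hamming (bitsB L₁) (bitsB L₂) + hamming (bitsB L₂) (bitsB L₃))
      ≡⟨ interchange (hamming (bitsA L₁) (bitsA L₂)) _ (hamming (bitsB L₁) (bitsB L₂)) _ ⟩
    changes L₁ L₂ + changes L₂ L₃ ∎
    where open ≤-Reasoning

  changes-SwapStep : ∀ {L L'} → SwapStep L L' → changes L L' ≤ 1
  changes-SwapStep (swapA a _ othersA sameB) =
    +-mono-≤ (hamming-≤-1 a (λ a' a'≢a → cong (β a') (sym (othersA a' a'≢a))))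
             (≤-reflexive (hamming-≗ (λ b → cong (γ b) (sym (sameB b)))))
  changes-SwapStep (swapB b _ othersB sameA) =
    +-mono-≤ (≤-reflexive (hamming-≗ (λ a → cong (β a) (sym (sameA a)))))
             (hamming-≤-1 b (λ b' b'≢b → cong (γ b') (sym (othersB b' b'≢b))))

  changes-Swaps : ∀ {k L L'} → Swaps k L L' → changes L L' ≤ k
  changes-Swaps {L = L} done = ≤-reflexive (changes-refl L)
  changes-Swaps {L = L} {L''} (step {L' = L'} s ss) = begin
    changes L L''                 ≤⟨ changes-triangle L L' L'' ⟩
    changes L L' + changes L' L'' ≤⟨ +-mono-≤ (changes-SwapStep s) (changes-Swaps ss) ⟩
    suc _                         ∎
    where open ≤-Reasoning

Before-total : ∀ {X : Set} {l : List X} {x y} → x ∈ l → y ∈ l → x ≢ y → Before x y l ⊎ Before y x l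
Before-total (Any.here refl)  (Any.here refl)  x≢y = ⊥-elim (x≢y refl)
Before-total (Any.here refl)  (Any.there y∈l) _   = inj₁ (here y∈l)
Before-total (Any.there x∈l)  (Any.here refl)  _   = inj₂ (here x∈l)
Before-total (Any.there x∈l)  (Any.there y∈l) x≢y = Sum.map there there (Before-total x∈l y∈l x≢y)

-- `x ≢ y` is part of the definition because lists reached by swaps are not assumed duplicate-free.
data Prefers {X : Set} (l : List X) : Maybe X → Maybe X → Set where
  prefers : ∀ {x y} → x ≢ y → Before x y l → Prefers l (just x) (just y)

module _ {X : Set} {l : List X} where

  Prefers⇒≢ : ∀ {m m'} → Prefers l m m' → m ≢ m'
  Prefers⇒≢ (prefers x≢y _) refl = x≢y refl

  Prefers⇒WouldPrefer : ∀ {x m} → Prefers l (just x) m → WouldPrefer l m x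
  Prefers⇒WouldPrefer (prefers _ x<y) = inj₂ (_ , refl , x<y)

  ¬Prefers⇒WouldPrefer : ∀ {m y} → (∀ x → m ≡ just x → x ∈ l) → y ∈ l → m ≢ just y →
    ¬ Prefers l m (just y) → WouldPrefer l m y
  ¬Prefers⇒WouldPrefer {nothing} _     _   _      _  = inj₁ refl
  ¬Prefers⇒WouldPrefer {just x}  m∈l y∈l m≢y ¬pref with Before-total (m∈l x refl) y∈l (m≢y ∘ cong just)
  ... | inj₁ x<y = ⊥-elim (¬pref (prefers (m≢y ∘ cong just) x<y))
  ... | inj₂ y<x = inj₂ (x , refl , y<x)

module _ {X : Set} (_≟ₓ_ : DecidableEquality X) where

  open DecMembership _≟ₓ_ using (_∈?_)

  before? : ∀ x y l → Dec (Before x y l)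
  before? x y []      = no λ ()
  before? x y (z ∷ l) = map′ to from ((z ≟ₓ x ×-dec y ∈? l) ⊎-dec before? x y l)
    where
    to : (z ≡ x × y ∈ l) ⊎ Before x y l → Before x y (z ∷ l)
    to (inj₁ (refl , y∈l)) = here y∈l
    to (inj₂ x<y)          = there x<y
    from : Before x y (z ∷ l) → (z ≡ x × y ∈ l) ⊎ Before x y l
    from (here y∈l)  = inj₁ (refl , y∈l)
    from (there x<y) = inj₂ x<y

  prefers? : ∀ l m m' → Dec (Prefers l m m')
  prefers? l nothing  _        = no λ ()
  prefers? l (just x) nothing  = no λ ()
  prefers? l (just x) (just y) =
    map′ (uncurry prefers) (λ { (prefers x≢y x<y) → x≢y , x<y }) (¬? (x ≟ₓ y) ×-dec before? x y l)

_≟ₘ_ : ∀ {n} → DecidableEquality (Maybe (Fin n))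
_≟ₘ_ = Maybe.≡-dec _≟_

maybe-as-∑ : ∀ {n} (g : Vector ℕ n) m →
  maybe g 0 m ≡ ∑[ j < n ] (if does (m ≟ₘ just j) then g j else 0)
maybe-as-∑ {n} g nothing  = sym (∑-zero n (λ _ → refl))
maybe-as-∑ {n} g (just i) = sym (begin
  ∑[ j < n ] (if does (i ≟ j) then g j else 0) ≡⟨ ∑-concentrated _ i off-diagonal ⟩
  (if does (i ≟ i) then g i else 0)            ≡⟨ cong (if_then g i else 0) (dec-true (i ≟ i) refl) ⟩
  g i                                          ∎)
  where
  open ≡-Reasoning
  off-diagonal : ∀ j → j ≢ i → (if does (i ≟ j) then g j else 0) ≡ 0
  off-diagonal j j≢i = cong (if_then g j else 0) (dec-false (i ≟ j) (j≢i ∘ sym))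

module _ {na nb : ℕ} {E : Graph na nb} (N : Matching E) where

  ∑-partners : (g : Vector ℕ nb) →
    ∑[ a < na ] maybe g 0 (mA N a) ≡ ∑[ b < nb ] maybe (const (g b)) 0 (mB N b)
  ∑-partners g = begin
    ∑[ a < na ] maybe g 0 (mA N a)
      ≡⟨ sum-cong-≗ (maybe-as-∑ g ∘ mA N) ⟩
    ∑[ a < na ] ∑[ b < nb ] (if does (mA N a ≟ₘ just b) then g b else 0)
      ≡⟨ ∑-comm (λ a b → if does (mA N a ≟ₘ just b) then g b else 0) ⟩
    ∑[ b < nb ] ∑[ a < na ] (if does (mA N a ≟ₘ just b) then g b else 0)
      ≡⟨ sum-cong-≗ (λ b → sum-cong-≗ (λ a →
           cong (if_then g b else 0) (does-⇔ (consistent N a b) (mA N a ≟ₘ just b) (mB N b ≟ₘ just a)))) ⟩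
    ∑[ b < nb ] ∑[ a < na ] (if does (mB N b ≟ₘ just a) then g b else 0)
      ≡⟨ sum-cong-≗ (λ b → sym (maybe-as-∑ (const (g b)) (mB N b))) ⟩
    ∑[ b < nb ] maybe (const (g b)) 0 (mB N b) ∎
    where open ≡-Reasoning

  ∑-partners-≤ : (g : Vector ℕ nb) → ∑[ a < na ] maybe g 0 (mA N a) ≤ sum g
  ∑-partners-≤ g = ≤-trans (≤-reflexive (∑-partners g)) (∑-mono-≤ (maybe-const-≤ ∘ mB N))
    where
    maybe-const-≤ : ∀ {b} m → maybe (const (g b)) 0 m ≤ g b
    maybe-const-≤ nothing  = z≤n
    maybe-const-≤ (just _) = ≤-refl

  ∑≡∑-partners : (g : Vector ℕ nb) → (∀ b → mB N b ≡ nothing → g b ≡ 0) →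
    sum g ≡ ∑[ a < na ] maybe g 0 (mA N a)
  ∑≡∑-partners g unmatched⇒0 = trans (sum-cong-≗ matched-only) (sym (∑-partners g))
    where
    matched-only : ∀ b → g b ≡ maybe (const (g b)) 0 (mB N b)
    matched-only b with mB N b in eq
    ... | nothing = unmatched⇒0 b eq
    ... | just _  = refl

module _ {na nb : ℕ} {E : Graph na nb} (L : Prefs na nb) (M : Matching E) (stable : Stable L M) where

  stable⇒endpoint-prefers-partner : ValidPrefs E L → ∀ {a b} → E a b → mA M a ≢ just b →
    Prefers (prefA L a) (mA M a) (just b) ⊎ Prefers (prefB L b) (mB M b) (just a)
  stable⇒endpoint-prefers-partner valid {a} {b} ab ab∉M
    with prefers? _≟_ (prefA L a) (mA M a) (just b) | prefers? _≟_ (prefB L b) (mB M b) (just a)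
  ... | yes a-prefers | _             = inj₁ a-prefers
  ... | no _          | yes b-prefers = inj₂ b-prefers
  ... | no ¬a-prefers | no ¬b-prefers = ⊥-elim (stable a b (ab , ab∉M ,
          ¬Prefers⇒WouldPrefer (λ x ax∈M → listedA (inE M a x ax∈M)) (listedA ab) ab∉M ¬a-prefers ,
          ¬Prefers⇒WouldPrefer (λ x bx∈M → listedB (inE M x b (from (consistent M x b) bx∈M)))
                               (listedB ab) (ab∉M ∘ from (consistent M a b)) ¬b-prefers))
    where
    open Equivalence
    listedA : ∀ {b} → E a b → b ∈ prefA L a
    listedA {b} = from (proj₂ (proj₁ valid a) b)
    listedB : ∀ {a} → E a b → a ∈ prefB L b
    listedB {a} = from (proj₂ (proj₂ valid b) a)

  stable⇒¬mutual-preference : ∀ {a b} → E a b →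
    ¬ (Prefers (prefA L a) (just b) (mA M a) × Prefers (prefB L b) (just a) (mB M b))
  stable⇒¬mutual-preference {a} {b} ab (a-prefers , b-prefers) = stable a b
    (ab , ≢-sym (Prefers⇒≢ a-prefers) , Prefers⇒WouldPrefer a-prefers , Prefers⇒WouldPrefer b-prefers)

transposePrefs : ∀ {na nb} → Prefs na nb → Prefs nb na
transposePrefs L = prefs (prefB L) (prefA L)

transposeMatching : ∀ {na nb} {E : Graph na nb} → Matching E → Matching (flip E)
transposeMatching M = matching (mB M) (mA M)
  (λ b a → mk⇔ (from (consistent M a b)) (to (consistent M a b)))
  (λ b a ba∈M → inE M a b (from (consistent M a b) ba∈M))
  where open Equivalence

module _ {na nb : ℕ} {E : Graph na nb} where

  ValidPrefs-transpose : ∀ {L} → ValidPrefs E L → ValidPrefs (flip E) (transposePrefs L)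
  ValidPrefs-transpose (validA , validB) = validB , validA

  Stable-transpose : ∀ L (M : Matching E) → Stable L M → Stable (transposePrefs L) (transposeMatching M)
  Stable-transpose L M stable b a (ab , ab∉M , b-would , a-would) =
    stable a b (ab , ab∉M ∘ Equivalence.to (consistent M a b) , a-would , b-would)

unmatched≡weight : ∀ {na nb} {E : Graph na nb} (M : Matching E) →
  unmatched M ≡ weight (is-nothing ∘ mA M) + weight (is-nothing ∘ mB M)
unmatched≡weight M =
  cong₂ _+_ (length-filter-tabulate (is-nothing ∘ mA M) id) (length-filter-tabulate (is-nothing ∘ mB M) id)

module PartnerComparison {na nb : ℕ} {E : Graph na nb} (M M' : Matching E) = LocalStatistic
  (λ a l → does (prefers? _≟_ l (mA M a) (mA M' a)))
  (λ b l → does (prefers? _≟_ l (mB M b) (mB M' b)))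

module _ {na nb : ℕ} {E : Graph na nb} (L L' : Prefs na nb) (M M' : Matching E)
  (valid : ValidPrefs E L) (stable : Stable L M) (stable' : Stable L' M')
  (perfectA : ∀ a → mA M' a ≢ nothing) where

  open PartnerComparison M M'
  open Equivalence

  moved : Vector Bool na
  moved a = not (does (mA M a ≟ₘ mA M' a))

  unmatched+prefers'≤moved : ∀ a →
    𝟙 (is-nothing (mA M a)) + 𝟙 (bitsA L' a) + maybe (𝟙 ∘ bitsB L') 0 (mA M a) ≤ 𝟙 (moved a)
  unmatched+prefers'≤moved a with mA M a in eq | mA M' a in eq'
  ... | _       | nothing = ⊥-elim (perfectA a eq')
  ... | nothing | just _  = ≤-refl
  ... | just b  | just b' with b ≟ b'
  ...   | yes refl = ≤-reflexive (cong 𝟙 (dec-false (prefers? _≟_ _ (mB M b) (mB M' b))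
            (λ b-prefers → Prefers⇒≢ b-prefers (trans (to (consistent M a b) eq) (sym (to (consistent M' a b) eq'))))))
  -- here the goal has already unfolded `prefers?` at `just b`, `just b'` down to `before?`
  ...   | no b≢b'  = 𝟙-does-¬× (before? _≟_ b b' (prefA L' a))
                                 (prefers? _≟_ (prefB L' b) (mB M b) (mB M' b))
            (λ (b<b' , b-prefers) → stable⇒¬mutual-preference L' M' stable' (inE M a b eq)
              (subst (Prefers (prefA L' a) (just b)) (sym eq') (prefers b≢b' b<b') ,
               subst (λ m → Prefers (prefB L' b) m (mB M' b)) (to (consistent M a b) eq) b-prefers))

  moved≤prefers : ∀ a → 𝟙 (moved a) ≤ 𝟙 (bitsA L a) + maybe (𝟙 ∘ bitsB L) 0 (mA M' a)
  moved≤prefers a with mA M' a in eq'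
  ... | nothing = ⊥-elim (perfectA a eq')
  ... | just b' with mA M a ≟ₘ just b'
  ...   | yes _     = z≤n
  ...   | no ab'∉M  = 𝟙-does-⊎ (prefers? _≟_ (prefA L a) (mA M a) (just b'))
                                 (prefers? _≟_ (prefB L b') (mB M b') (mB M' b'))
            (Sum.map₂ (subst (Prefers (prefB L b') (mB M b')) (sym (to (consistent M' a b') eq')))
              (stable⇒endpoint-prefers-partner L M stable valid (inE M' a b' eq') ab'∉M))

  unmatched+count'≤weight-moved : weight (is-nothing ∘ mA M) + count L' ≤ weight moved
  unmatched+count'≤weight-moved = begin
    sum u + (sum q + weight (bitsB L'))  ≡⟨ cong (λ t → sum u + (sum q + t)) (∑≡∑-partners M (𝟙 ∘ bitsB L') unmatched⇒0) ⟩
    sum u + (sum q + sum qM)             ≡⟨ sym (+-assoc (sum u) (sum q) (sum qM)) ⟩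
    sum u + sum q + sum qM               ≡⟨ cong (_+ sum qM) (∑-distrib-+ u q) ⟨
    ∑[ a < na ] (u a + q a) + sum qM     ≡⟨ ∑-distrib-+ (λ a → u a + q a) qM ⟨
    ∑[ a < na ] (u a + q a + qM a)       ≤⟨ ∑-mono-≤ unmatched+prefers'≤moved ⟩
    weight moved                         ∎
    where
    open ≤-Reasoning
    u q qM : Vector ℕ na
    u  a = 𝟙 (is-nothing (mA M a))
    q  a = 𝟙 (bitsA L' a)
    qM a = maybe (𝟙 ∘ bitsB L') 0 (mA M a)
    unmatched⇒0 : ∀ b → mB M b ≡ nothing → 𝟙 (bitsB L' b) ≡ 0
    unmatched⇒0 b eq rewrite eq = refl

  weight-moved≤count : weight moved ≤ count L
  weight-moved≤count = begin
    weight moved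
      ≤⟨ ∑-mono-≤ moved≤prefers ⟩
    ∑[ a < na ] (𝟙 (bitsA L a) + maybe (𝟙 ∘ bitsB L) 0 (mA M' a))
      ≡⟨ ∑-distrib-+ (𝟙 ∘ bitsA L) _ ⟩
    weight (bitsA L) + ∑[ a < na ] maybe (𝟙 ∘ bitsB L) 0 (mA M' a)
      ≤⟨ +-monoʳ-≤ (weight (bitsA L)) (∑-partners-≤ M' (𝟙 ∘ bitsB L)) ⟩
    count L ∎
    where open ≤-Reasoning

  unmatchedA≤changes : weight (is-nothing ∘ mA M) ≤ changes L L'
  unmatchedA≤changes = +-cancelʳ-≤ (count L') _ _ (begin
    weight (is-nothing ∘ mA M) + count L' ≤⟨ unmatched+count'≤weight-moved ⟩
    weight moved                          ≤⟨ weight-moved≤count ⟩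
    count L                               ≤⟨ count-≤-count+changes L L' ⟩
    count L' + changes L L'               ≡⟨ +-comm (count L') _ ⟩
    changes L L' + count L'               ∎)
    where open ≤-Reasoning

proposition1 : ∀ {na nb : ℕ} (E : Graph na nb) (L : Prefs na nb) →
    ValidPrefs E L →
    ∀ (k : ℕ) (L' : Prefs na nb) → Swaps k L L' → HasPerfectStable E L' →
    ∀ (M : Matching E) → Stable L M → unmatched M ≤ 2 * k
proposition1 E L valid k L' swaps (M' , stable' , perfectA , perfectB) M stable = begin
  unmatched M
    ≡⟨ unmatched≡weight M ⟩
  weight (is-nothing ∘ mA M) + weight (is-nothing ∘ mB M)
    ≤⟨ +-mono-≤ (unmatchedA≤changes L L' M M' valid stable stable' perfectA)
                (unmatchedA≤changes (transposePrefs L) (transposePrefs L') (transposeMatching M) (transposeMatching M')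
                   (ValidPrefs-transpose valid) (Stable-transpose L M stable) (Stable-transpose L' M' stable') perfectB) ⟩
  changes L L' + (hamming (bitsB L) (bitsB L') + hamming (bitsA L) (bitsA L'))
    ≡⟨ cong (changes L L' +_) (+-comm (hamming (bitsB L) (bitsB L')) _) ⟩
  changes L L' + changes L L'
    ≤⟨ +-mono-≤ (changes-Swaps swaps) (changes-Swaps swaps) ⟩
  k + k
    ≡⟨ cong (k +_) (sym (+-identityʳ k)) ⟩
  2 * k ∎
  where
  open ≤-Reasoning
  open PartnerComparison M M'
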